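{- Let $d>1$ and $N\geq 0$ be integers, and let $c,m$ be integers with $0\leq c<m$. Suppose that $\operatorname{rem}(n,d)=\operatorname{div}(\operatorname{rem}(c\cdot n,m)\cdot d,\,m)$ for all integers $n\in[0,N]$. Then $\operatorname{div}(n,d)=\operatorname{div}(c\cdot n,m)$ for all integers $n\in[0,N]$.
   Context: For a non-negative real $x$ and a positive real $y$, define $\operatorname{div}(x,y)=\lfloor x/y\rfloor$ and $\operatorname{rem}(x,y)=x-\lfloor x/y\rfloor\cdot y$, where $\lfloor\cdot\rfloor$ is the floor function. -}

module Defs where

-- Passing from n to n + 1, the quotient n / d (resp. c n / m) grows by one exactly
-- when the remainder n % d (resp. c n % m) decreases, and otherwise stays put.  The
-- hypothesis makes n % d a monotone function of c n % m, so the two remainders cannot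
-- move in opposite directions: if c n % m decreased while n % d grew we would get a
-- contradiction at once, and if n % d wrapped to 0 while c n % m grew, monotonicity
-- would force n % d = 0, i.e. d = 1.  By induction from n = 0 the quotients agree.

module Submission where

open import Defs
open import Data.Nat using (ℕ; _*_; _≤_; _<_; NonZero)
open import Data.Nat.DivMod using (_/_; _%_)
open import Relation.Binary.PropositionalEquality using (_≡_)

open import Data.Nat using (zero; suc; _+_; _∸_; _<?_)
open import Data.Nat.DivMod using (m≡m%n+[m/n]*n; m%n<n; +-distrib-/-∣ʳ; m<n⇒m/n≡0; m*n/n≡m; [m+kn]%n≡m%n; m<n⇒m%n≡m; /-monoˡ-≤; 0/n≡0)
open import Data.Nat.Divisibility using (divides-refl)
open import Data.Nat.Properties
open import Data.Product using (_×_; _,_; proj₁; proj₂)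
open import Data.Sum using (_⊎_; inj₁; inj₂)
open import Relation.Nullary using (yes; no; contradiction)
open import Relation.Binary.PropositionalEquality
  using (refl; sym; trans; cong; cong₂; subst; subst₂; module ≡-Reasoning)

divMod-unique : ∀ {a r q k} .{{_ : NonZero k}} → a ≡ r + q * k → r < k →
                a / k ≡ q × a % k ≡ r
divMod-unique {r = r} {q} {k} refl r<k =
  ( (begin
      (r + q * k) / k     ≡⟨ +-distrib-/-∣ʳ r (divides-refl q) ⟩
      r / k + q * k / k   ≡⟨ cong₂ _+_ (m<n⇒m/n≡0 r<k) (m*n/n≡m q k) ⟩
      q                   ∎)
  , trans ([m+kn]%n≡m%n r q k) (m<n⇒m%n≡m r<k))
  where open ≡-Reasoning

+-/-%-step : ∀ s a k .{{_ : NonZero k}} → s < k →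
  (s + a) / k ≡ a / k × (s + a) % k ≡ s + a % k ⊎
  (s + a) / k ≡ suc (a / k) × (s + a) % k + k ≡ s + a % k
+-/-%-step s a k s<k with s + a % k <? k
... | yes no-wrap = inj₁ (divMod-unique s+a≡ no-wrap)
  where
  s+a≡ : s + a ≡ (s + a % k) + a / k * k
  s+a≡ = trans (cong (s +_) (m≡m%n+[m/n]*n a k)) (sym (+-assoc s (a % k) _))
... | no wrap = inj₂ (proj₁ unique , trans (cong (_+ k) (proj₂ unique)) (m∸n+n≡m k≤s+r))
  where
  k≤s+r = ≮⇒≥ wrap
  s+r∸k<k : s + a % k ∸ k < k
  s+r∸k<k = +-cancelʳ-< k _ _ (begin-strict
    (s + a % k ∸ k) + k  ≡⟨ m∸n+n≡m k≤s+r ⟩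
    s + a % k            <⟨ +-mono-< s<k (m%n<n a k) ⟩
    k + k                ∎)
    where open ≤-Reasoning
  s+a≡ : s + a ≡ (s + a % k ∸ k) + suc (a / k) * k
  s+a≡ = begin
    s + a                              ≡⟨ cong (s +_) (m≡m%n+[m/n]*n a k) ⟩
    s + (a % k + a / k * k)            ≡⟨ +-assoc s (a % k) _ ⟨
    (s + a % k) + a / k * k            ≡⟨ cong (_+ a / k * k) (m∸n+n≡m k≤s+r) ⟨
    ((s + a % k ∸ k) + k) + a / k * k  ≡⟨ +-assoc (s + a % k ∸ k) k _ ⟩
    (s + a % k ∸ k) + suc (a / k) * k  ∎
    where open ≡-Reasoning
  unique = divMod-unique s+a≡ s+r∸k<k

module _ {d c m : ℕ} .{{_ : NonZero d}} .{{_ : NonZero m}} (1<d : 1 < d) (c<m : c < m) where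

  /-agree-suc : ∀ n → n % d ≡ (c * n % m) * d / m → suc n % d ≡ (c * suc n % m) * d / m →
                n / d ≡ c * n / m → suc n / d ≡ c * suc n / m
  /-agree-suc n r≡ r′≡ ih rewrite *-suc c n
    with +-/-%-step 1 n d 1<d | +-/-%-step c (c * n) m c<m
  ... | inj₁ (q′≡q , _) | inj₁ (Q′≡Q , _) = trans q′≡q (trans ih (sym Q′≡Q))
  ... | inj₂ (q′≡1+q , _) | inj₂ (Q′≡1+Q , _) = trans q′≡1+q (trans (cong suc ih) (sym Q′≡1+Q))
  ... | inj₁ (_ , r′≡1+r) | inj₂ (_ , R′+m≡c+R) =
    contradiction r′≤r (<⇒≱ (≤-reflexive (sym r′≡1+r)))
    where
    R′<R : (c + c * n) % m < c * n % m
    R′<R = +-cancelʳ-< m _ _ (begin-strict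
      (c + c * n) % m + m  ≡⟨ R′+m≡c+R ⟩
      c + c * n % m        <⟨ +-monoˡ-< (c * n % m) c<m ⟩
      m + c * n % m        ≡⟨ +-comm m _ ⟩
      c * n % m + m        ∎)
      where open ≤-Reasoning
    r′≤r : suc n % d ≤ n % d
    r′≤r = subst₂ _≤_ (sym r′≡) (sym r≡) (/-monoˡ-≤ m (*-monoˡ-≤ d (<⇒≤ R′<R)))
  ... | inj₂ (_ , r′+d≡1+r) | inj₁ (_ , R′≡c+R) = contradiction d≤1 (<⇒≱ 1<d)
    where
    R≤R′ : c * n % m ≤ (c + c * n) % m
    R≤R′ = subst (c * n % m ≤_) (sym R′≡c+R) (m≤n+m _ c)
    r≤r′ : n % d ≤ suc n % d
    r≤r′ = subst₂ _≤_ (sym r≡) (sym r′≡) (/-monoˡ-≤ m (*-monoˡ-≤ d R≤R′))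
    d≤1 : d ≤ 1
    d≤1 = +-cancelʳ-≤ (n % d) d 1 (begin
      d + n % d        ≤⟨ +-monoʳ-≤ d r≤r′ ⟩
      d + suc n % d    ≡⟨ +-comm d _ ⟩
      suc n % d + d    ≡⟨ r′+d≡1+r ⟩
      1 + n % d        ∎)
      where open ≤-Reasoning

lemma3 : (d N c m : ℕ) → 1 < d → c < m →
    .{{_ : NonZero d}} → .{{_ : NonZero m}} →
    (∀ n → n ≤ N → n % d ≡ ((((c * n) % m) * d) / m)) →
    ∀ n → n ≤ N → n / d ≡ (c * n) / m
lemma3 d N c m 1<d c<m digits = go
  where
  go : ∀ n → n ≤ N → n / d ≡ (c * n) / m
  go zero _ = trans (0/n≡0 d) (sym (trans (cong (_/ m) (*-zeroʳ c)) (0/n≡0 m)))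
  go (suc n) 1+n≤N =
    /-agree-suc 1<d c<m n (digits n n≤N) (digits (suc n) 1+n≤N) (go n n≤N)
    where n≤N = ≤-trans (n≤1+n n) 1+n≤N
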